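{- Let $f:2^X\to\mathbb{R}_{\ge0}$ be a monotone nondecreasing function (not necessarily submodular) with curvature at most $c\in[0,1]$, and let $\mathcal{M}=(X,\mathcal{I})$ be a matroid. Let $S$ be the base produced by the standard greedy minimization algorithm on $f$ and $\mathcal{M}$, and let $O$ be any base of $\mathcal{M}$. Then $f(S)\le\frac{1}{1-c}f(O)$.
   Context: $f_A(j)=f(A\cup\{j\})-f(A)$. For a monotone function, the (generalized) curvature is $c=1-\min_{j\in X}\min_{S,T\subseteq X\setminus\{j\}}\frac{f_S(j)}{f_T(j)}$; for nondecreasing $f$, curvature at most $c$ means $(1-c)f_B(j)\le f_A(j)$ for all $j\in X$, $A,B\subseteq X\setminus\{j\}$. The standard greedy minimization algorithm starts from $S=\emptyset$ and repeatedly adds to $S$ an element $e\notin S$ with $S\cup\{e\}\in\mathcal{I}$ minimizing $f_S(e)$, terminating only when no element can be added. -}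

module Defs where

open import Level using (Level; _⊔_) renaming (suc to lsuc)
open import Data.Nat using (ℕ; _<_)
open import Data.Fin using (Fin)
open import Data.Fin.Subset using (Subset; ⊥; ⁅_⁆; _∪_; _∈_; _∉_; _⊆_; ∣_∣)
open import Data.Product using (Σ; ∃; _×_)
open import Relation.Nullary using (¬_)
open import Relation.Binary.PropositionalEquality using (_≡_)
open import Relation.Binary.Structures using (IsTotalOrder)
open import Algebra.Bundles using (CommutativeRing)

-- Scalars: an arbitrary linearly ordered field (ℝ is an instance).
-- The standard library has no real numbers, so we state the result
-- for every ordered field.

record OrderedField (a ℓ : Level) : Set (lsuc (a ⊔ ℓ)) where
  field
    commutativeRing : CommutativeRing a ℓ
  open CommutativeRing commutativeRing public
  field
    _≤_          : Carrier → Carrier → Set ℓ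
    isTotalOrder : IsTotalOrder _≈_ _≤_
    +-mono-≤     : ∀ {x y} z → x ≤ y → (x + z) ≤ (y + z)
    *-nonneg     : ∀ {x y} → 0# ≤ x → 0# ≤ y → 0# ≤ (x * y)
    0≉1          : ¬ (0# ≈ 1#)
    inverse      : ∀ x → ¬ (x ≈ 0#) → ∃ λ y → (x * y) ≈ 1#

  infixl 6 _−_
  _−_ : Carrier → Carrier → Carrier
  x − y = x + (- y)

module _ {a ℓ : Level} (F : OrderedField a ℓ) where
  open OrderedField F

  SetFun : ℕ → Set a
  SetFun n = Subset n → Carrier

  marginal : ∀ {n} → SetFun n → Subset n → Fin n → Carrier
  marginal f A j = f (A ∪ ⁅ j ⁆) − f A

  NonNegative : ∀ {n} → SetFun n → Set ℓ
  NonNegative f = ∀ A → 0# ≤ f A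

  Monotone : ∀ {n} → SetFun n → Set ℓ
  Monotone f = ∀ A B → A ⊆ B → f A ≤ f B

  CurvatureAtMost : ∀ {n} → SetFun n → Carrier → Set ℓ
  CurvatureAtMost f c =
    ∀ j A B → j ∉ A → j ∉ B → ((1# − c) * marginal f B j) ≤ marginal f A j

record Matroid (ℓ : Level) (n : ℕ) : Set (lsuc ℓ) where
  field
    Indep       : Subset n → Set ℓ
    indep-empty : Indep ⊥
    indep-down  : ∀ {A B} → A ⊆ B → Indep B → Indep A
    exchange    : ∀ {A B} → Indep A → Indep B → ∣ A ∣ < ∣ B ∣ →
                  ∃ λ x → x ∈ B × x ∉ A × Indep (A ∪ ⁅ x ⁆)

module _ {ℓ' : Level} {n : ℕ} (M : Matroid ℓ' n) where
  open Matroid M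

  IsBase : Subset n → Set ℓ'
  IsBase B = Indep B × (∀ A → Indep A → B ⊆ A → A ≡ B)

-- Standard greedy minimisation (with arbitrary tie-breaking).
-- GreedyRun F M f S T : starting from current set S, some execution of
-- the greedy algorithm terminates with output T.

data GreedyRun {a ℓ ℓ' : Level} {n : ℕ} (F : OrderedField a ℓ)
               (M : Matroid ℓ' n) (f : SetFun F n)
               : Subset n → Subset n → Set (a ⊔ ℓ ⊔ ℓ') where
  done : ∀ {S} →
         (∀ e → e ∉ S → ¬ Matroid.Indep M (S ∪ ⁅ e ⁆)) →
         GreedyRun F M f S S
  step : ∀ {S T} (e : Fin n) →
         e ∉ S →
         Matroid.Indep M (S ∪ ⁅ e ⁆) →
         (∀ e′ → e′ ∉ S → Matroid.Indep M (S ∪ ⁅ e′ ⁆) →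
            OrderedField._≤_ F (marginal F f S e) (marginal F f S e′)) →
         GreedyRun F M f (S ∪ ⁅ e ⁆) T →
         GreedyRun F M f S T

module Submission where

-- Write k = 1 − c.  Follow a greedy run P₀ = ∅ ⊂ P₁ ⊂ … ⊂ Pₘ = S backwards,
-- carrying an independent set Oᵢ with ∣Pᵢ∣ ≤ ∣Oᵢ∣, starting from the base O.
-- At the step Pᵢ → Pᵢ ∪ {e}, matroid exchange yields o ∈ Oᵢ₊₁ \ Pᵢ with
-- Pᵢ ∪ {o} independent, and we put Oᵢ = Oᵢ₊₁ − o.  Since e was the cheapest
-- feasible extension, and by curvature,
--     k·f_{Pᵢ}(e) ≤ k·f_{Pᵢ}(o) ≤ f_{Oᵢ}(o) = f(Oᵢ₊₁) − f(Oᵢ),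
-- so the scaled greedy increments telescope against the losses of the Oᵢ:
--     k·f(S) + f(O₀) ≤ f(O) + k·f(∅).
-- As k·f(∅) ≤ f(∅) ≤ f(O₀), this gives k·f(S) ≤ f(O), and dividing by k
-- (multiplying by its inverse y) proves the theorem.

open import Defs
open import Level using (Level; _⊔_)
open import Data.Nat using (ℕ)
open import Data.Fin.Subset using (Subset; ⊥)

import Data.Nat as ℕ
import Data.Nat.Properties as ℕ
open import Data.Fin using (Fin; zero; suc)
open import Data.Fin.Subset using (_∪_; ⁅_⁆; _∈_; _∉_; ∣_∣; inside; outside) renaming (_-_ to _∖_)
open import Data.Fin.Subset.Properties using (p─⊥≡p; ∪-identityʳ; p⊆p∪q; q⊆p∪q; x∈⁅x⁆; p─q⊆p; ⊥⊆)
open import Data.Vec using (_∷_; here; there)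
open import Data.Product using (∃; _×_; _,_)
open import Data.Sum using (inj₁; inj₂)
open import Data.Empty using (⊥-elim)
open import Relation.Nullary using (yes; no)
open import Relation.Binary.PropositionalEquality using (_≡_; cong; subst)
import Relation.Binary.PropositionalEquality as ≡
open import Relation.Binary.Bundles using (Preorder)
import Relation.Binary.Structures as Structures
import Relation.Binary.Reasoning.Preorder as PreorderReasoning
import Algebra.Properties.Ring as RingProperties
import Algebra.Properties.Group as GroupProperties
import Algebra.Solver.CommutativeMonoid as CommutativeMonoidSolver

x∈p⇒p∖x∪⁅x⁆≡p : ∀ {n} {x : Fin n} {p : Subset n} → x ∈ p → (p ∖ x) ∪ ⁅ x ⁆ ≡ p
x∈p⇒p∖x∪⁅x⁆≡p {x = zero}  {p = inside ∷ p}  here      =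
  cong (inside ∷_) (≡.trans (cong (_∪ ⊥) (p─⊥≡p p)) (∪-identityʳ p))
x∈p⇒p∖x∪⁅x⁆≡p {x = suc x} {p = inside ∷ p}  (there i) = cong (inside ∷_) (x∈p⇒p∖x∪⁅x⁆≡p i)
x∈p⇒p∖x∪⁅x⁆≡p {x = suc x} {p = outside ∷ p} (there i) = cong (outside ∷_) (x∈p⇒p∖x∪⁅x⁆≡p i)

x∈p⇒1+∣p∖x∣≡∣p∣ : ∀ {n} {x : Fin n} {p : Subset n} → x ∈ p → ℕ.suc ∣ p ∖ x ∣ ≡ ∣ p ∣
x∈p⇒1+∣p∖x∣≡∣p∣ {x = zero}  {p = inside ∷ p}  here      = cong (λ q → ℕ.suc ∣ q ∣) (p─⊥≡p p)
x∈p⇒1+∣p∖x∣≡∣p∣ {x = suc x} {p = inside ∷ p}  (there i) = cong ℕ.suc (x∈p⇒1+∣p∖x∣≡∣p∣ i)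
x∈p⇒1+∣p∖x∣≡∣p∣ {x = suc x} {p = outside ∷ p} (there i) = x∈p⇒1+∣p∖x∣≡∣p∣ i

x∉p⇒∣p∪⁅x⁆∣≡1+∣p∣ : ∀ {n} {x : Fin n} {p : Subset n} → x ∉ p → ∣ p ∪ ⁅ x ⁆ ∣ ≡ ℕ.suc ∣ p ∣
x∉p⇒∣p∪⁅x⁆∣≡1+∣p∣ {x = zero}  {p = inside ∷ p}  x∉p = ⊥-elim (x∉p here)
x∉p⇒∣p∪⁅x⁆∣≡1+∣p∣ {x = zero}  {p = outside ∷ p} x∉p = cong (λ q → ℕ.suc ∣ q ∣) (∪-identityʳ p)
x∉p⇒∣p∪⁅x⁆∣≡1+∣p∣ {x = suc x} {p = inside ∷ p}  x∉p = cong ℕ.suc (x∉p⇒∣p∪⁅x⁆∣≡1+∣p∣ (λ i → x∉p (there i)))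
x∉p⇒∣p∪⁅x⁆∣≡1+∣p∣ {x = suc x} {p = outside ∷ p} x∉p = x∉p⇒∣p∪⁅x⁆∣≡1+∣p∣ (λ i → x∉p (there i))

x∉p∖x : ∀ {n} {x : Fin n} (p : Subset n) → x ∉ p ∖ x
x∉p∖x {x = zero}  (_       ∷ p) ()
x∉p∖x {x = suc x} (inside  ∷ p) (there i) = x∉p∖x p i
x∉p∖x {x = suc x} (outside ∷ p) (there i) = x∉p∖x p i

x∉p∧∣p∪⁅x⁆∣≤∣q∣⇒∣p∣<∣q∣ : ∀ {n} {x : Fin n} {p q : Subset n} →
                          x ∉ p → ∣ p ∪ ⁅ x ⁆ ∣ ℕ.≤ ∣ q ∣ → ∣ p ∣ ℕ.< ∣ q ∣
x∉p∧∣p∪⁅x⁆∣≤∣q∣⇒∣p∣<∣q∣ {q = q} x∉p = subst (ℕ._≤ ∣ q ∣) (x∉p⇒∣p∪⁅x⁆∣≡1+∣p∣ x∉p)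

∣p∣<∣q∣∧x∈q⇒∣p∣≤∣q∖x∣ : ∀ {n} {x : Fin n} {p q : Subset n} →
                        ∣ p ∣ ℕ.< ∣ q ∣ → x ∈ q → ∣ p ∣ ℕ.≤ ∣ q ∖ x ∣
∣p∣<∣q∣∧x∈q⇒∣p∣≤∣q∖x∣ {p = p} ∣p∣<∣q∣ x∈q =
  ℕ.≤-pred (subst (ℕ.suc ∣ p ∣ ℕ.≤_) (≡.sym (x∈p⇒1+∣p∖x∣≡∣p∣ x∈q)) ∣p∣<∣q∣)

module OrderedFieldProperties {a ℓ : Level} (F : OrderedField a ℓ) where

  open OrderedField F hiding (_≤_)
  open OrderedField F public using () renaming (_≤_ to infix 4 _≤_)
  open Structures.IsTotalOrder isTotalOrder public
    using (total; antisym) renaming (reflexive to ≤-reflexive; ≲-respˡ-≈ to ≤-respˡ-≈; ≲-respʳ-≈ to ≤-respʳ-≈)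
  open RingProperties ring using (-1*x≈-x; -‿distribʳ-*; x[y-z]≈xy-xz; [y-z]x≈yx-zx)
  open GroupProperties +-group using (ε⁻¹≈ε; ⁻¹-involutive)
  open CommutativeMonoidSolver +-commutativeMonoid using (solve; _⊕_; _⊜_)

  ≤-preorder : Preorder a ℓ ℓ
  ≤-preorder = record { isPreorder = Structures.IsTotalOrder.isPreorder isTotalOrder }

  open PreorderReasoning ≤-preorder

  −-+-cancel : ∀ x u v → (x − u) + (u + v) ≈ x + v
  −-+-cancel x u v = begin-equality
    (x + - u) + (u + v)  ≈⟨ solve 4 (λ x m u v → (x ⊕ m) ⊕ (u ⊕ v) ⊜ (x ⊕ v) ⊕ (u ⊕ m)) refl x (- u) u v ⟩
    (x + v) + (u + - u)  ≈⟨ +-congˡ (-‿inverseʳ u) ⟩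
    (x + v) + 0#         ≈⟨ +-identityʳ (x + v) ⟩
    x + v                ∎

  +-monoˡ-≤ : ∀ {x y} z → x ≤ y → z + x ≤ z + y
  +-monoˡ-≤ {x} {y} z x≤y = begin
    z + x  ≈⟨ +-comm z x ⟩
    x + z  ≲⟨ +-mono-≤ z x≤y ⟩
    y + z  ≈⟨ +-comm y z ⟩
    z + y  ∎

  +-mono₂-≤ : ∀ {x y u v} → x ≤ y → u ≤ v → x + u ≤ y + v
  +-mono₂-≤ {y = y} {u} x≤y u≤v = begin
    _ + u  ≲⟨ +-mono-≤ u x≤y ⟩
    y + u  ≲⟨ +-monoˡ-≤ y u≤v ⟩
    y + _  ∎

  +-cancelʳ-≤ : ∀ {x y} z → x + z ≤ y + z → x ≤ y
  +-cancelʳ-≤ {x} {y} z x+z≤y+z = begin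
    x                   ≈⟨ cancel x ⟨
    (x + z) + - z       ≲⟨ +-mono-≤ (- z) x+z≤y+z ⟩
    (y + z) + - z       ≈⟨ cancel y ⟩
    y                   ∎
    where
    cancel : ∀ w → (w + z) + - z ≈ w
    cancel w = begin-equality
      (w + z) + - z  ≈⟨ +-assoc w z (- z) ⟩
      w + (z + - z)  ≈⟨ +-congˡ (-‿inverseʳ z) ⟩
      w + 0#         ≈⟨ +-identityʳ w ⟩
      w              ∎

  ≤⇒0≤− : ∀ {x y} → x ≤ y → 0# ≤ y − x
  ≤⇒0≤− {x} {y} x≤y = begin
    0#      ≈⟨ -‿inverseʳ x ⟨
    x − x   ≲⟨ +-mono-≤ (- x) x≤y ⟩
    y − x   ∎

  0≤−⇒≤ : ∀ {x y} → 0# ≤ y − x → x ≤ y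
  0≤−⇒≤ {x} {y} 0≤y−x = begin
    x                   ≈⟨ +-identityˡ x ⟨
    0# + x              ≲⟨ +-mono-≤ x 0≤y−x ⟩
    (y − x) + x         ≈⟨ +-congˡ (+-identityʳ x) ⟨
    (y − x) + (x + 0#)  ≈⟨ −-+-cancel y x 0# ⟩
    y + 0#              ≈⟨ +-identityʳ y ⟩
    y                   ∎

  -‿anti-≤ : ∀ {x y} → x ≤ y → - y ≤ - x
  -‿anti-≤ {x} {y} x≤y = 0≤−⇒≤ (≤-respʳ-≈ y−x≈-x−-y (≤⇒0≤− x≤y))
    where
    y−x≈-x−-y : y − x ≈ - x − - y
    y−x≈-x−-y = begin-equality
      y + - x      ≈⟨ +-comm y (- x) ⟩
      - x + y      ≈⟨ +-congˡ (⁻¹-involutive y) ⟨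
      - x + - - y  ∎

  x≤0⇒0≤-x : ∀ {x} → x ≤ 0# → 0# ≤ - x
  x≤0⇒0≤-x x≤0 = ≤-respˡ-≈ ε⁻¹≈ε (-‿anti-≤ x≤0)

  *-monoˡ-≤ : ∀ {x y} z → 0# ≤ z → x ≤ y → z * x ≤ z * y
  *-monoˡ-≤ {x} {y} z 0≤z x≤y =
    0≤−⇒≤ (≤-respʳ-≈ (x[y-z]≈xy-xz z y x) (*-nonneg 0≤z (≤⇒0≤− x≤y)))

  −-≤-swap : ∀ {x u y v} → x − u ≤ y − v → x + v ≤ y + u
  −-≤-swap {x} {u} {y} {v} le = begin
    x + v                ≈⟨ −-+-cancel x u v ⟨
    (x − u) + (u + v)    ≲⟨ +-mono-≤ (u + v) le ⟩
    (y − v) + (u + v)    ≈⟨ +-congˡ (+-comm u v) ⟩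
    (y − v) + (v + u)    ≈⟨ −-+-cancel y v u ⟩
    y + u                ∎

  +-≤-telescope : ∀ {x u w y v z} → x + u ≤ w + y → y + v ≤ u + z → x + v ≤ w + z
  +-≤-telescope {x} {u} {w} {y} {v} {z} le₁ le₂ = +-cancelʳ-≤ (u + y) (begin
    (x + v) + (u + y)    ≈⟨ solve 4 (λ x u y v → (x ⊕ v) ⊕ (u ⊕ y) ⊜ (x ⊕ u) ⊕ (y ⊕ v)) refl x u y v ⟩
    (x + u) + (y + v)    ≲⟨ +-mono₂-≤ le₁ le₂ ⟩
    (w + y) + (u + z)    ≈⟨ solve 4 (λ w y u z → (w ⊕ y) ⊕ (u ⊕ z) ⊜ (w ⊕ z) ⊕ (u ⊕ y)) refl w y u z ⟩
    (w + z) + (u + y)    ∎)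

  -- In an ordered field 1 is positive, since 1 = (−1)·(−1) is a square.
  0≤1 : 0# ≤ 1#
  0≤1 with total 0# 1#
  ... | inj₁ le = le
  ... | inj₂ 1≤0 = begin
    0#           ≲⟨ *-nonneg 0≤-1 0≤-1 ⟩
    - 1# * - 1#  ≈⟨ -1*x≈-x (- 1#) ⟩
    - - 1#       ≈⟨ ⁻¹-involutive 1# ⟩
    1#           ∎
    where
    0≤-1 : 0# ≤ - 1#
    0≤-1 = x≤0⇒0≤-x 1≤0

  1−c-shrinks : ∀ {c z} → 0# ≤ c → 0# ≤ z → (1# − c) * z ≤ z
  1−c-shrinks {c} {z} 0≤c 0≤z = begin
    (1# − c) * z     ≈⟨ [y-z]x≈yx-zx z 1# c ⟩
    1# * z − c * z   ≈⟨ +-congʳ (*-identityˡ z) ⟩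
    z + - (c * z)    ≲⟨ +-monoˡ-≤ z (-‿anti-≤ (*-nonneg 0≤c 0≤z)) ⟩
    z + - 0#         ≈⟨ +-congˡ ε⁻¹≈ε ⟩
    z + 0#           ≈⟨ +-identityʳ z ⟩
    z                ∎

  inverse-nonneg : ∀ {k y} → 0# ≤ k → k * y ≈ 1# → 0# ≤ y
  inverse-nonneg {k} {y} 0≤k ky≈1 with total 0# y
  ... | inj₁ 0≤y = 0≤y
  ... | inj₂ y≤0 = ⊥-elim (0≉1 (antisym 0≤1 1≤0))
    where
    0≤-1 : 0# ≤ - 1#
    0≤-1 = begin
      0#        ≲⟨ *-nonneg 0≤k (x≤0⇒0≤-x y≤0) ⟩
      k * - y   ≈⟨ -‿distribʳ-* k y ⟨
      - (k * y) ≈⟨ -‿cong ky≈1 ⟩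
      - 1#      ∎
    1≤0 : 1# ≤ 0#
    1≤0 = ≤-respˡ-≈ (⁻¹-involutive 1#) (≤-respʳ-≈ ε⁻¹≈ε (-‿anti-≤ 0≤-1))

  ≤-divide : ∀ {k y a b} → 0# ≤ k → k * y ≈ 1# → k * a ≤ b → a ≤ y * b
  ≤-divide {k} {y} {a} {b} 0≤k ky≈1 ka≤b = begin
    a            ≈⟨ *-identityˡ a ⟨
    1# * a       ≈⟨ *-congʳ (trans (*-comm y k) ky≈1) ⟨
    (y * k) * a  ≈⟨ *-assoc y k a ⟩
    y * (k * a)  ≲⟨ *-monoˡ-≤ y (inverse-nonneg 0≤k ky≈1) ka≤b ⟩
    y * b        ∎

-- Matroids: an independent set is never larger than a base, since
-- otherwise the exchange axiom would extend the base.

independent≤base : ∀ {ℓ' n} (M : Matroid ℓ' n) {I B : Subset n} →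
                   Matroid.Indep M I → IsBase M B → ∣ I ∣ ℕ.≤ ∣ B ∣
independent≤base M {I} {B} indI (indB , maximal) with ∣ I ∣ ℕ.≤? ∣ B ∣
... | yes ∣I∣≤∣B∣ = ∣I∣≤∣B∣
... | no ∣I∣≰∣B∣ with Matroid.exchange M indB indI (ℕ.≰⇒> ∣I∣≰∣B∣)
...   | x , _ , x∉B , indB∪x = ⊥-elim (x∉B x∈B)
  where
  x∈B : x ∈ B
  x∈B = subst (x ∈_) (maximal (B ∪ ⁅ x ⁆) indB∪x (p⊆p∪q ⁅ x ⁆)) (q⊆p∪q B ⁅ x ⁆ (x∈⁅x⁆ x))

augment : ∀ {ℓ' n} (M : Matroid ℓ' n) {P O : Subset n} {e : Fin n} →
          e ∉ P → Matroid.Indep M (P ∪ ⁅ e ⁆) → Matroid.Indep M O → ∣ P ∪ ⁅ e ⁆ ∣ ℕ.≤ ∣ O ∣ →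
          ∃ λ o → o ∈ O × o ∉ P × Matroid.Indep M (P ∪ ⁅ o ⁆) × ∣ P ∣ ℕ.≤ ∣ O ∖ o ∣
augment M {P} {O} {e} e∉P indP∪e indO ∣P∪e∣≤∣O∣ =
  let o , o∈O , o∉P , indP∪o = Matroid.exchange M (Matroid.indep-down M (p⊆p∪q ⁅ e ⁆) indP∪e) indO ∣P∣<∣O∣
  in  o , o∈O , o∉P , indP∪o , ∣p∣<∣q∣∧x∈q⇒∣p∣≤∣q∖x∣ {p = P} ∣P∣<∣O∣ o∈O
  where
  ∣P∣<∣O∣ : ∣ P ∣ ℕ.< ∣ O ∣
  ∣P∣<∣O∣ = x∉p∧∣p∪⁅x⁆∣≤∣q∣⇒∣p∣<∣q∣ {q = O} e∉P ∣P∪e∣≤∣O∣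

greedy-indep : ∀ {a ℓ ℓ' n} {F : OrderedField a ℓ} {M : Matroid ℓ' n} {f : SetFun F n} {P T : Subset n} →
               GreedyRun F M f P T → Matroid.Indep M P → Matroid.Indep M T
greedy-indep (done _)                indP = indP
greedy-indep (step _ _ indP∪e _ run) _   = greedy-indep run indP∪e

module CurvatureAnalysis {a ℓ ℓ' n} (F : OrderedField a ℓ) (M : Matroid ℓ' n)
  (f : SetFun F n) (c : OrderedField.Carrier F) (curvature : CurvatureAtMost F f c)
  (0≤k : OrderedField._≤_ F (OrderedField.0# F) (OrderedField._−_ F (OrderedField.1# F) c)) where

  open OrderedField F hiding (_≤_)
  open OrderedFieldProperties F
  open PreorderReasoning ≤-preorder
  open RingProperties ring using (x[y-z]≈xy-xz)
  open Matroid M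

  k : Carrier
  k = 1# − c

  Cheapest : Subset n → Fin n → Set (ℓ ⊔ ℓ')
  Cheapest P e = ∀ e′ → e′ ∉ P → Indep (P ∪ ⁅ e′ ⁆) → marginal F f P e ≤ marginal F f P e′

  exchange-step : ∀ {P e O o} → Cheapest P e → o ∈ O → o ∉ P → Indep (P ∪ ⁅ o ⁆) →
                  k * f (P ∪ ⁅ e ⁆) + f (O ∖ o) ≤ f O + k * f P
  exchange-step {P} {e} {O} {o} cheapest o∈O o∉P indP∪o = −-≤-swap (begin
    k * f (P ∪ ⁅ e ⁆) − k * f P  ≈⟨ x[y-z]≈xy-xz k (f (P ∪ ⁅ e ⁆)) (f P) ⟨
    k * marginal F f P e         ≲⟨ *-monoˡ-≤ k 0≤k (cheapest o o∉P indP∪o) ⟩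
    k * marginal F f P o         ≲⟨ curvature o (O ∖ o) P (x∉p∖x O) o∉P ⟩
    marginal F f (O ∖ o) o       ≡⟨ cong (λ X → f X − f (O ∖ o)) (x∈p⇒p∖x∪⁅x⁆≡p o∈O) ⟩
    f O − f (O ∖ o)              ∎)

  greedy-invariant : ∀ {P T O} → GreedyRun F M f P T → Indep O → ∣ T ∣ ℕ.≤ ∣ O ∣ →
                     ∃ λ O′ → Indep O′ × ∣ P ∣ ℕ.≤ ∣ O′ ∣ × k * f T + f O′ ≤ f O + k * f P
  greedy-invariant {T = T} {O} (done _) indO ∣T∣≤∣O∣ =
    O , indO , ∣T∣≤∣O∣ , ≤-reflexive (+-comm (k * f T) (f O))
  greedy-invariant (step e e∉P indP∪e cheapest run) indO ∣T∣≤∣O∣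
    with greedy-invariant run indO ∣T∣≤∣O∣
  ... | O₁ , indO₁ , ∣P∪e∣≤∣O₁∣ , invariant₁
    with augment M e∉P indP∪e indO₁ ∣P∪e∣≤∣O₁∣
  ...   | o , o∈O₁ , o∉P , indP∪o , ∣P∣≤∣O₁∖o∣ =
    O₁ ∖ o , indep-down (p─q⊆p O₁ ⁅ o ⁆) indO₁ , ∣P∣≤∣O₁∖o∣ ,
    +-≤-telescope invariant₁ (exchange-step cheapest o∈O₁ o∉P indP∪o)

  greedy-vs-base : NonNegative F f → Monotone F f → 0# ≤ c →
                   ∀ {S O} → GreedyRun F M f ⊥ S → IsBase M O → k * f S ≤ f O
  greedy-vs-base nonneg mono 0≤c {S} {O} run base@(indO , _)
    with greedy-invariant run indO (independent≤base M (greedy-indep run indep-empty) base)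
  ... | O′ , _ , _ , invariant = +-cancelʳ-≤ (f O′) (begin
    k * f S + f O′  ≲⟨ invariant ⟩
    f O + k * f ⊥   ≲⟨ +-monoˡ-≤ (f O) k·f∅≤f[O′] ⟩
    f O + f O′      ∎)
    where
    k·f∅≤f[O′] : k * f ⊥ ≤ f O′
    k·f∅≤f[O′] = begin
      k * f ⊥  ≲⟨ 1−c-shrinks 0≤c (nonneg ⊥) ⟩
      f ⊥      ≲⟨ mono ⊥ O′ ⊥⊆ ⟩
      f O′     ∎

theorem12 : ∀ {a ℓ ℓ' : Level} (F : OrderedField a ℓ) (n : ℕ)
    (M : Matroid ℓ' n) (f : SetFun F n) (c : OrderedField.Carrier F) →
    NonNegative F f → Monotone F f →
    OrderedField._≤_ F (OrderedField.0# F) c → OrderedField._≤_ F c (OrderedField.1# F) →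
    CurvatureAtMost F f c →
    (S O : Subset n) → GreedyRun F M f ⊥ S → IsBase M O →
    (y : OrderedField.Carrier F) →
    OrderedField._≈_ F (OrderedField._*_ F (OrderedField._−_ F (OrderedField.1# F) c) y) (OrderedField.1# F) →
    OrderedField._≤_ F (f S) (OrderedField._*_ F y (f O))
theorem12 F n M f c nonneg mono 0≤c c≤1 curvature S O run base y ky≈1 =
  ≤-divide 0≤k ky≈1 (greedy-vs-base nonneg mono 0≤c run base)
  where
  open OrderedField F using (0#; 1#; _−_)
  open OrderedFieldProperties F
  0≤k : 0# ≤ 1# − c
  0≤k = ≤⇒0≤− c≤1
  open CurvatureAnalysis F M f c curvature 0≤k
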